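{- For every positive integer $n$, the number of rooted trees on $[n]_0$ with no doubly record-covering pairs equals the number of rooted trees on $[n]_0$ in which $n$ is a child of the root $0$.
   Context: A rooted tree on $[n]_0$ is a labeled tree with vertex set $\{0,1,\dots,n\}$ rooted at $0$; the root $0$ is never a record, and a non-root node is a record if its label is the largest among the non-root nodes on its path to the root. Two records $R,R'$ form a doubly record-covering pair if $R$ is a proper ancestor of $R'$, $R<R'$, and no record has label strictly between $R$ and $R'$. -}

module Defs where

open import Data.Nat using (ℕ; zero; suc)
open import Data.Fin using (Fin; zero; suc; toℕ; fromℕ; _<_; _≤_)
open import Data.Fin.Properties using (_≟_; _<?_; _≤?_; all?; any?)
open import Data.Vec using (Vec; []; _∷_; lookup)
open import Data.List using (List; []; _∷_; map; concatMap; allFin; filter; length)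
open import Data.Product using (_×_; ∃; _,_)
open import Relation.Nullary using (¬_; Dec; ¬?)
open import Relation.Nullary.Decidable using (_→-dec_) renaming (_×-dec_ to _×?_)
open import Relation.Binary.PropositionalEquality using (_≡_; _≢_)

-- A rooted tree on [n]_0 = {0,…,n}, rooted at 0, is encoded by its parent
-- vector: entry i (i : Fin n) is the parent of vertex (suc i).  The vector
-- encodes a tree iff every vertex reaches the root 0 by following parents.

ParentVec : ℕ → Set
ParentVec n = Vec (Fin (suc n)) n

par : ∀ {n} → ParentVec n → Fin (suc n) → Fin (suc n)
par v zero    = zero
par v (suc i) = lookup v i

iter : ∀ {n} → ParentVec n → ℕ → Fin (suc n) → Fin (suc n)
iter v zero    x = x
iter v (suc k) x = par v (iter v k x)

IsTree : ∀ {n} → ParentVec n → Set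
IsTree {n} v = ∀ x → iter v n x ≡ zero

IsRecord : ∀ {n} → ParentVec n → Fin (suc n) → Set
IsRecord {n} v x =
  x ≢ zero × (∀ (k : Fin (suc n)) → iter v (toℕ k) x ≢ zero → iter v (toℕ k) x ≤ x)

ProperAncestor : ∀ {n} → ParentVec n → Fin (suc n) → Fin (suc n) → Set
ProperAncestor {n} v a b = ∃ λ (k : Fin n) → iter v (suc (toℕ k)) b ≡ a

IsDRCPair : ∀ {n} → ParentVec n → Fin (suc n) → Fin (suc n) → Set
IsDRCPair {n} v R R' =
  IsRecord v R × IsRecord v R' × ProperAncestor v R R' × R < R' ×
  (∀ r → IsRecord v r → R < r → ¬ (r < R'))

NoDRCPair : ∀ {n} → ParentVec n → Set
NoDRCPair {n} v = ∀ R R' → ¬ IsDRCPair v R R'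

isRecord? : ∀ {n} (v : ParentVec n) x → Dec (IsRecord v x)
isRecord? v x = ¬? (x ≟ zero) ×? all? (λ k → ¬? (iter v (toℕ k) x ≟ zero) →-dec (iter v (toℕ k) x ≤? x))

properAncestor? : ∀ {n} (v : ParentVec n) a b → Dec (ProperAncestor v a b)
properAncestor? v a b = any? (λ k → iter v (suc (toℕ k)) b ≟ a)

isDRCPair? : ∀ {n} (v : ParentVec n) R R' → Dec (IsDRCPair v R R')
isDRCPair? v R R' =
  isRecord? v R ×? isRecord? v R' ×? properAncestor? v R R' ×? (R <? R') ×?
  all? (λ r → isRecord? v r →-dec ((R <? r) →-dec ¬? (r <? R')))

noDRCPair? : ∀ {n} (v : ParentVec n) → Dec (NoDRCPair v)
noDRCPair? v = all? (λ R → all? (λ R' → ¬? (isDRCPair? v R R')))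

isTree? : ∀ {n} (v : ParentVec n) → Dec (IsTree v)
isTree? {n} v = all? (λ x → iter v n x ≟ zero)

allVecs : ∀ {m} k → List (Vec (Fin m) k)
allVecs {m} zero    = [] ∷ []
allVecs {m} (suc k) = concatMap (λ a → map (a ∷_) (allVecs k)) (allFin m)

countNoDRC : ℕ → ℕ
countNoDRC n = length (filter (λ v → isTree? v ×? noDRCPair? v) (allVecs n))

countNChildOfRoot : ℕ → ℕ
countNChildOfRoot n =
  length (filter (λ v → isTree? v ×? (par v (fromℕ n) ≟ zero)) (allVecs n))

{-# OPTIONS --safe #-}
-- Let pathMax v x be the largest label on the path from x to the root, so that the records are
-- the non-root x with pathMax v x = x; list them as r₁ < ⋯ < rₖ = n.  Re-hang every rᵢ under the
-- old parent of rᵢ₊₁ (rₖ under the root) and keep all other parents; the reverse shift re-hangs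
-- rᵢ under the old parent of rᵢ₋₁ (r₁ under the root).  If every record is re-hung under a vertex
-- whose pathMax is smaller than the record, pathMax cannot increase along the new paths, so the
-- result is again a tree with the same records.  For the reverse shift this is automatic.  For the
-- forward shift, the path maximum of the parent of rᵢ₊₁ is a record smaller than rᵢ₊₁, hence at
-- most rᵢ, and it equals rᵢ exactly when (rᵢ , rᵢ₊₁) is a doubly record-covering pair.  The same
-- monotonicity shows that the reverse shift creates no such pair.  As r₁ always hangs under the
-- root, the two shifts are mutually inverse between the two families of trees being counted.
module Submission where

open import Defs
open import Data.Empty using (⊥-elim)
open import Data.Fin as Fin using (Fin; zero; suc; toℕ; fromℕ; fromℕ<; punchOut)
open import Data.Fin.Induction using (<-wellFounded; >-wellFounded)
open import Data.Fin.Properties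
  using (_≟_; any?; toℕ-injective; toℕ-fromℕ; toℕ-fromℕ<; toℕ≤pred[n]; ≤fromℕ; <-cmp;
         punchOut-injective; pigeonhole)
  renaming (_<?_ to _<ᶠ?_; ≤-antisym to ≤ᶠ-antisym)
open import Data.List
  using (List; []; _∷_; _++_; map; concatMap; filter; length; allFin; cartesianProductWith)
open import Data.List.Membership.Propositional using (_∈_)
open import Data.List.Membership.Propositional.Properties
  using (∈-map⁺; ∈-map⁻; ∈-filter⁺; ∈-filter⁻; ∈-allFin; ∈-cartesianProductWith⁺)
open import Data.List.Membership.Propositional.Properties.WithK using (unique∧set⇒bag)
open import Data.List.Properties using (length-map; map-∘; map-id-local)
open import Data.List.Relation.Binary.BagAndSetEquality using (_∼[_]_; set; ∼bag⇒↭)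
open import Data.List.Relation.Binary.Permutation.Propositional.Properties using (↭-length)
open import Data.List.Relation.Unary.All as All using ([])
open import Data.List.Relation.Unary.All.Properties using (all-filter)
open import Data.List.Relation.Unary.AllPairs using ([]; _∷_)
open import Data.List.Relation.Unary.Any using (here)
open import Data.List.Relation.Unary.Unique.Propositional using (Unique)
import Data.List.Relation.Unary.Unique.Propositional.Properties as Unique
open import Data.Nat using (ℕ; zero; suc; _+_; _*_; _∸_; _⊔_; _≤_; _<_; z≤n; s≤s; z<s)
open import Data.Nat.Properties
  using (_≤?_; _<?_; ≤-refl; ≤-trans; ≤-pred; <⇒≤; <-trans; <-≤-trans; ≤-<-trans; <-irrefl;
         ≤∧≢⇒<; ≮⇒≥; ≰⇒>; <⇒≱; n<1+n; n≤1+n; n≤0⇒n≡0; m≤m+n; m≤m*n; m∸n+n≡m;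
         m≤n⇒∃[o]m+o≡n; +-comm; m≤m⊔n; m≤n⊔m; ⊔-lub; ⊔-sel; module ≤-Reasoning)
open import Data.Product using (_×_; _,_; proj₁; proj₂; ∃; ∃₂)
open import Data.Sum using (_⊎_; inj₁; inj₂; [_,_]′)
open import Data.Vec using (Vec; []; _∷_; lookup; tabulate)
open import Data.Vec.Properties using (∷-injective; lookup∘tabulate; tabulate∘lookup; tabulate-cong)
open import Function using (_∘_; flip; mk⇔)
open import Induction.WellFounded using (WellFounded; Acc; acc)
open import Level using (0ℓ)
open import Relation.Binary using (Rel; Trichotomous; tri<; tri≈; tri>)
  renaming (Decidable to Decidable₂)
import Relation.Binary.Construct.Flip.EqAndOrd as Flip
open import Relation.Binary.PropositionalEquality
open import Relation.Nullary using (¬_; Dec; yes; no; contradiction)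
open import Relation.Nullary.Decidable using (map′; _×-dec_)
open import Relation.Unary using (Pred; Decidable; _⊆_; _≐_)

module _ {A : Set} {P Q : Pred A 0ℓ} (P? : Decidable P) (Q? : Decidable Q)
         {xs : List A} (xs-unique : Unique xs) (xs-complete : ∀ a → a ∈ xs)
         (f g : A → A) (f-PQ : ∀ {a} → P a → Q (f a)) (g-QP : ∀ {a} → Q a → P (g a))
         (g∘f : ∀ {a} → P a → g (f a) ≡ a) (f∘g : ∀ {a} → Q a → f (g a) ≡ a) where

  length-filter-≡ : length (filter P? xs) ≡ length (filter Q? xs)
  length-filter-≡ = begin
    length Ps             ≡⟨ length-map f Ps ⟨
    length (map f Ps)     ≡⟨ ↭-length (∼bag⇒↭ (unique∧set⇒bag fPs-unique Qs-unique same-elements)) ⟩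
    length (filter Q? xs) ∎
    where
    open ≡-Reasoning
    Ps = filter P? xs
    Qs-unique = Unique.filter⁺ Q? xs-unique

    g∘f-Ps : map g (map f Ps) ≡ Ps
    g∘f-Ps = trans (sym (map-∘ Ps)) (map-id-local (All.map g∘f (all-filter P? xs)))

    fPs-unique : Unique (map f Ps)
    fPs-unique = Unique.map⁻ (subst Unique (sym g∘f-Ps) (Unique.filter⁺ P? xs-unique))

    same-elements : map f Ps ∼[ set ] filter Q? xs
    same-elements {w} = mk⇔ to from
      where
      to : w ∈ map f Ps → w ∈ filter Q? xs
      to w∈ with ∈-map⁻ f w∈
      ... | a , a∈ , refl = ∈-filter⁺ Q? (xs-complete (f a)) (f-PQ (proj₂ (∈-filter⁻ P? {xs = xs} a∈)))
      from : w ∈ filter Q? xs → w ∈ map f Ps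
      from w∈ = subst (_∈ map f Ps) (f∘g Qw) (∈-map⁺ f (∈-filter⁺ P? (xs-complete (g w)) (g-QP Qw)))
        where Qw = proj₂ (∈-filter⁻ Q? {xs = xs} w∈)

concatMap-map≡cartesianProductWith : ∀ {A B C : Set} (f : A → B → C) (as : List A) (bs : List B) →
  concatMap (λ a → map (f a) bs) as ≡ cartesianProductWith f as bs
concatMap-map≡cartesianProductWith f []       bs = refl
concatMap-map≡cartesianProductWith f (a ∷ as) bs =
  cong (map (f a) bs ++_) (concatMap-map≡cartesianProductWith f as bs)

allVecs-suc : ∀ {m} k → allVecs {m} (suc k) ≡ cartesianProductWith _∷_ (allFin m) (allVecs k)
allVecs-suc {m} k = concatMap-map≡cartesianProductWith _∷_ (allFin m) (allVecs k)

allVecs-complete : ∀ {m} k (v : Vec (Fin m) k) → v ∈ allVecs k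
allVecs-complete zero    []      = here refl
allVecs-complete (suc k) (a ∷ v) =
  subst (a ∷ v ∈_) (sym (allVecs-suc k)) (∈-cartesianProductWith⁺ _∷_ (∈-allFin a) (allVecs-complete k v))

allVecs-unique : ∀ {m} k → Unique (allVecs {m} k)
allVecs-unique zero        = [] ∷ []
allVecs-unique {m} (suc k) = subst Unique (sym (allVecs-suc k))
  (Unique.cartesianProductWith⁺ _∷_ ∷-injective (Unique.allFin⁺ m) (allVecs-unique k))

-- Neighbours in a decidable subset of Fin m

record SearchableOrder (m : ℕ) : Set₁ where
  field
    _≺_           : Rel (Fin m) 0ℓ
    _≺?_          : Decidable₂ _≺_
    ≺-wellFounded : WellFounded _≺_
    ≺-compare     : Trichotomous _≡_ _≺_

ascending : ∀ {m} → SearchableOrder m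
ascending = record
  { _≺_ = Fin._<_ ; _≺?_ = _<ᶠ?_ ; ≺-wellFounded = <-wellFounded ; ≺-compare = <-cmp }

descending : ∀ {m} → SearchableOrder m
descending = record
  { _≺_ = Fin._>_ ; _≺?_ = flip _<ᶠ?_ ; ≺-wellFounded = >-wellFounded
  ; ≺-compare = Flip.compare Fin._<_ <-cmp }

Next : ∀ {m} → Rel (Fin m) 0ℓ → Pred (Fin m) 0ℓ → Rel (Fin m) 0ℓ
Next _≺_ P x y = P y × x ≺ y × (∀ z → P z → x ≺ z → ¬ z ≺ y)

Next-flip : ∀ {m} {_≺_ : Rel (Fin m) 0ℓ} {P x y} → P x → Next _≺_ P x y → Next (flip _≺_) P y x
Next-flip Px (_ , x≺y , between) = Px , x≺y , λ z Pz z≺y x≺z → between z Pz x≺z z≺y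

Next-resp-≐ : ∀ {m} {_≺_ : Rel (Fin m) 0ℓ} {P Q x y} → P ≐ Q → Next _≺_ P x y → Next _≺_ Q x y
Next-resp-≐ (P⊆Q , Q⊆P) (Py , x≺y , between) = P⊆Q Py , x≺y , λ z Qz → between z (Q⊆P Qz)

module _ {m} (O : SearchableOrder m) where
  open SearchableOrder O

  ≺-minimal : ∀ {Q : Pred (Fin m) 0ℓ} → Decidable Q → ∀ {z} → Q z →
    ∃ λ y → Q y × (∀ w → Q w → ¬ w ≺ y)
  ≺-minimal {Q} Q? Qz = go (≺-wellFounded _) Qz
    where
    go : ∀ {z} → Acc _≺_ z → Q z → ∃ λ y → Q y × (∀ w → Q w → ¬ w ≺ y)
    go {z} (acc smaller) Qz with any? (λ w → Q? w ×-dec w ≺? z)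
    ... | yes (w , Qw , w≺z) = go (smaller w≺z) Qw
    ... | no ∄w              = z , Qz , λ w Qw w≺z → ∄w (w , Qw , w≺z)

  module _ {P : Pred (Fin m) 0ℓ} (P? : Decidable P) where

    Next-exists : ∀ {x z} → P z → x ≺ z → ∃ (Next _≺_ P x)
    Next-exists {x} Pz x≺z with ≺-minimal (λ y → P? y ×-dec x ≺? y) (Pz , x≺z)
    ... | y , (Py , x≺y) , minimal = y , Py , x≺y , λ w Pw x≺w → minimal w (Pw , x≺w)

    next? : ∀ x → Dec (∃ (Next _≺_ P x))
    next? x = map′ (λ (_ , Pz , x≺z) → Next-exists Pz x≺z) (λ (y , Py , x≺y , _) → y , Py , x≺y)
                   (any? (λ z → P? z ×-dec x ≺? z))

    ∄Next⇒last : ∀ {x} → ¬ ∃ (Next _≺_ P x) → ∀ z → P z → ¬ x ≺ z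
    ∄Next⇒last ∄next z Pz x≺z = ∄next (Next-exists Pz x≺z)

  Next-unique : ∀ {P x y y′} → Next _≺_ P x y → Next _≺_ P x y′ → y ≡ y′
  Next-unique {y = y} {y′} (Py , x≺y , between) (Py′ , x≺y′ , between′) with ≺-compare y y′
  ... | tri< y≺y′ _ _ = contradiction y≺y′ (between′ y Py x≺y)
  ... | tri≈ _ y≡y′ _ = y≡y′
  ... | tri> _ _ y′≺y = contradiction y′≺y (between y′ Py′ x≺y′)

-- Paths to the root

ReachesRoot : ∀ {n} → ParentVec n → Fin (suc n) → Set
ReachesRoot v x = ∃ λ k → iter v k x ≡ zero

module _ {n} (v : ParentVec n) where

  iter-suc : ∀ k x → iter v (suc k) x ≡ iter v k (par v x)
  iter-suc zero    x = refl
  iter-suc (suc k) x = cong (par v) (iter-suc k x)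

  iter-+ : ∀ j k x → iter v (j + k) x ≡ iter v j (iter v k x)
  iter-+ zero    k x = refl
  iter-+ (suc j) k x = cong (par v) (iter-+ j k x)

  iter-root : ∀ k → iter v k zero ≡ zero
  iter-root zero    = refl
  iter-root (suc k) = cong (par v) (iter-root k)

  iter-root-mono : ∀ {j k x} → iter v j x ≡ zero → j ≤ k → iter v k x ≡ zero
  iter-root-mono {j} {k} {x} reach j≤k = begin
    iter v k x                 ≡⟨ cong (λ i → iter v i x) (m∸n+n≡m j≤k) ⟨
    iter v (k ∸ j + j) x       ≡⟨ iter-+ (k ∸ j) j x ⟩
    iter v (k ∸ j) (iter v j x) ≡⟨ cong (iter v (k ∸ j)) reach ⟩
    iter v (k ∸ j) zero        ≡⟨ iter-root (k ∸ j) ⟩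
    zero                       ∎
    where open ≡-Reasoning

  reachesRoot-par : ∀ {x} → ReachesRoot v (par v x) → ReachesRoot v x
  reachesRoot-par {x} (k , reach) = suc k , trans (iter-suc k x) reach

  iter-periodic : ∀ {p y} → iter v p y ≡ y → ∀ m → iter v (m * p) y ≡ y
  iter-periodic         cycle zero    = refl
  iter-periodic {p} {y} cycle (suc m) =
    trans (iter-+ p (m * p) y) (trans (cong (iter v p) (iter-periodic cycle m)) cycle)

  cycle-root : ∀ {d y} → ReachesRoot v y → iter v (suc d) y ≡ y → y ≡ zero
  cycle-root {d} (k , reach) cycle =
    trans (sym (iter-periodic cycle k)) (iter-root-mono reach (m≤m*n k (suc d)))

  repeat-root : ∀ {x i j} → ReachesRoot v x → i < j → iter v i x ≡ iter v j x → iter v i x ≡ zero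
  repeat-root {x} {i} (k , reach) i<j repeat with m≤n⇒∃[o]m+o≡n i<j
  ... | d , refl = cycle-root {d} (k , reach-from-y) cycle
    where
    open ≡-Reasoning
    cycle : iter v (suc d) (iter v i x) ≡ iter v i x
    cycle = begin
      iter v (suc d) (iter v i x) ≡⟨ iter-+ (suc d) i x ⟨
      iter v (suc d + i) x        ≡⟨ cong (λ e → iter v (suc e) x) (+-comm d i) ⟩
      iter v (suc i + d) x        ≡⟨ repeat ⟨
      iter v i x                  ∎
    reach-from-y : iter v k (iter v i x) ≡ zero
    reach-from-y = trans (sym (iter-+ k i x)) (iter-root-mono reach (m≤m+n k i))

  -- A path avoiding the root for n steps visits n + 1 non-root vertices, so it repeats one.
  reachesRoot-bounded : ∀ {x} → ReachesRoot v x → iter v n x ≡ zero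
  reachesRoot-bounded {x} reaches with iter v n x ≟ zero
  ... | yes root = root
  ... | no ¬root = ⊥-elim (collide (pigeonhole (n<1+n n) (λ j → punchOut (nonroot j))))
    where
    nonroot : ∀ (j : Fin (suc n)) → zero ≢ iter v (toℕ j) x
    nonroot j root = ¬root (iter-root-mono (sym root) (toℕ≤pred[n] j))
    collide : ¬ ∃₂ λ i j → i Fin.< j × punchOut (nonroot i) ≡ punchOut (nonroot j)
    collide (i , j , i<j , same) =
      nonroot i (sym (repeat-root reaches i<j (punchOut-injective (nonroot i) (nonroot j) same)))

  reachesRoot⇒IsTree : (∀ x → ReachesRoot v x) → IsTree v
  reachesRoot⇒IsTree reaches x = reachesRoot-bounded (reaches x)

maxLabel : ∀ {n} → ParentVec n → ℕ → Fin (suc n) → ℕ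
maxLabel v zero    x = toℕ x
maxLabel v (suc k) x = toℕ x ⊔ maxLabel v k (par v x)

pathMax : ∀ {n} → ParentVec n → Fin (suc n) → ℕ
pathMax {n} v = maxLabel v n

module _ {n} (v : ParentVec n) where

  maxLabel-ub : ∀ {i} k x → i ≤ k → toℕ (iter v i x) ≤ maxLabel v k x
  maxLabel-ub {zero}  zero    x _         = ≤-refl
  maxLabel-ub {zero}  (suc k) x _         = m≤m⊔n (toℕ x) _
  maxLabel-ub {suc i} (suc k) x (s≤s i≤k) = begin
    toℕ (iter v (suc i) x)     ≡⟨ cong toℕ (iter-suc v i x) ⟩
    toℕ (iter v i (par v x))   ≤⟨ maxLabel-ub k (par v x) i≤k ⟩
    maxLabel v k (par v x)     ≤⟨ m≤n⊔m (toℕ x) _ ⟩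
    maxLabel v (suc k) x       ∎
    where open ≤-Reasoning

  maxLabel-lub : ∀ {b} k x → (∀ i → i ≤ k → toℕ (iter v i x) ≤ b) → maxLabel v k x ≤ b
  maxLabel-lub zero    x bound = bound 0 z≤n
  maxLabel-lub {b} (suc k) x bound = ⊔-lub (bound 0 z≤n) (maxLabel-lub k (par v x) bound-par)
    where
    bound-par : ∀ i → i ≤ k → toℕ (iter v i (par v x)) ≤ b
    bound-par i i≤k = subst (λ y → toℕ y ≤ b) (iter-suc v i x) (bound (suc i) (s≤s i≤k))

  maxLabel-attained : ∀ k x → ∃ λ i → toℕ (iter v i x) ≡ maxLabel v k x
  maxLabel-attained zero    x = 0 , refl
  maxLabel-attained (suc k) x with ⊔-sel (toℕ x) (maxLabel v k (par v x))
  ... | inj₁ at-x = 0 , sym at-x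
  ... | inj₂ above-x with maxLabel-attained k (par v x)
  ...   | i , at-i = suc i , trans (cong toℕ (iter-suc v i x)) (trans at-i (sym above-x))

  maxLabel-root : ∀ k → maxLabel v k zero ≡ 0
  maxLabel-root zero    = refl
  maxLabel-root (suc k) = maxLabel-root k

  label≤pathMax : ∀ x → toℕ x ≤ pathMax v x
  label≤pathMax x = maxLabel-ub n x z≤n

  pathMax-lub : ∀ {b} x → (∀ i → toℕ (iter v i x) ≤ b) → pathMax v x ≤ b
  pathMax-lub x bound = maxLabel-lub n x (λ i _ → bound i)

  record⇒pathMax≤ : ∀ {x} → IsRecord v x → pathMax v x ≤ toℕ x
  record⇒pathMax≤ {x} (_ , below) = maxLabel-lub n x λ i i≤n →
    subst (λ j → toℕ (iter v j x) ≤ toℕ x) (toℕ-fromℕ< (s≤s i≤n)) (bounded (fromℕ< (s≤s i≤n)))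
    where
    bounded : ∀ (k : Fin (suc n)) → toℕ (iter v (toℕ k) x) ≤ toℕ x
    bounded k with iter v (toℕ k) x ≟ zero
    ... | yes root = subst (λ y → toℕ y ≤ toℕ x) (sym root) z≤n
    ... | no ¬root = below k ¬root

  pathMax≤⇒record : ∀ {x} → x ≢ zero → pathMax v x ≤ toℕ x → IsRecord v x
  pathMax≤⇒record {x} x≢0 max≤x = x≢0 , λ k _ → ≤-trans (maxLabel-ub n x (toℕ≤pred[n] k)) max≤x

  pathMax-root<record : ∀ {x} → IsRecord v x → pathMax v zero < toℕ x
  pathMax-root<record {zero}  (0≢0 , _) = contradiction refl 0≢0
  pathMax-root<record {suc x} _         = subst (_< suc (toℕ x)) (sym (maxLabel-root n)) z<s

fromℕ-record : ∀ {n} (v : ParentVec (suc n)) → IsRecord v (fromℕ (suc n))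
fromℕ-record {n} v = pathMax≤⇒record v (λ ()) (pathMax-lub v _ λ i →
  subst (toℕ (iter v i (fromℕ (suc n))) ≤_) (sym (toℕ-fromℕ (suc n))) (toℕ≤pred[n] (iter v i _)))

module _ {n} {v : ParentVec n} (tree : IsTree v) where

  iter-≥-root : ∀ {k} x → n ≤ k → iter v k x ≡ zero
  iter-≥-root x n≤k = iter-root-mono v (tree x) n≤k

  iter≤pathMax : ∀ i x → toℕ (iter v i x) ≤ pathMax v x
  iter≤pathMax i x with i ≤? n
  ... | yes i≤n = maxLabel-ub v n x i≤n
  ... | no  i≰n = subst (λ y → toℕ y ≤ pathMax v x) (sym (iter-≥-root x (<⇒≤ (≰⇒> i≰n)))) z≤n

  pathMax-par : ∀ x → pathMax v (par v x) ≤ pathMax v x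
  pathMax-par x = pathMax-lub v (par v x) λ i →
    subst (λ y → toℕ y ≤ pathMax v x) (iter-suc v i x) (iter≤pathMax (suc i) x)

  pathMax≤label⊔pathMax-par : ∀ x → pathMax v x ≤ toℕ x ⊔ pathMax v (par v x)
  pathMax≤label⊔pathMax-par x = pathMax-lub v x λ
    { zero    → m≤m⊔n (toℕ x) _
    ; (suc i) → ≤-trans (subst (λ y → toℕ y ≤ _) (sym (iter-suc v i x)) (iter≤pathMax i (par v x)))
                        (m≤n⊔m (toℕ x) _) }

  nonrecord-pathMax≤pathMax-par : ∀ {x} → x ≢ zero → ¬ IsRecord v x →
    pathMax v x ≤ pathMax v (par v x)
  nonrecord-pathMax≤pathMax-par {x} x≢0 ¬record with ⊔-sel (toℕ x) (pathMax v (par v x))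
  ... | inj₁ at-x   = contradiction (pathMax≤⇒record v x≢0 (subst (pathMax v x ≤_) at-x max≤)) ¬record
    where max≤ = pathMax≤label⊔pathMax-par x
  ... | inj₂ at-par = subst (pathMax v x ≤_) at-par (pathMax≤label⊔pathMax-par x)

  -- A label equal to y above y would close a cycle through y.
  pathMax-par<record : ∀ {y} → IsRecord v y → pathMax v (par v y) < toℕ y
  pathMax-par<record {y} y-record@(y≢0 , _) with maxLabel-attained v n (par v y)
  ... | i , at-i = ≤∧≢⇒< (≤-trans (pathMax-par y) (record⇒pathMax≤ v y-record)) λ max≡y →
    y≢0 (cycle-root v {i} (n , tree y) (trans (iter-suc v i y) (toℕ-injective (trans at-i max≡y))))

  pathMax-attained-at-record : ∀ {x} → x ≢ zero →
    ∃ λ i → IsRecord v (iter v i x) × toℕ (iter v i x) ≡ pathMax v x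
  pathMax-attained-at-record {x} x≢0 with maxLabel-attained v n x
  ... | i , at-i = i , pathMax≤⇒record v z≢0 z-bound , at-i
    where
    z≢0 : iter v i x ≢ zero
    z≢0 z≡0 = x≢0 (toℕ-injective (n≤0⇒n≡0
      (subst (toℕ x ≤_) (trans (sym at-i) (cong toℕ z≡0)) (label≤pathMax v x))))
    z-bound : pathMax v (iter v i x) ≤ toℕ (iter v i x)
    z-bound = pathMax-lub v (iter v i x) λ j → subst₂ _≤_
      (cong toℕ (iter-+ v j i x)) (sym at-i) (iter≤pathMax (j + i) x)

  least-record-child-of-root : ∀ {x} → IsRecord v x → (∀ z → IsRecord v z → ¬ z Fin.< x) →
    par v x ≡ zero
  least-record-child-of-root {x} x-record least with par v x ≟ zero
  ... | yes root = root
  ... | no ¬root with pathMax-attained-at-record ¬root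
  ...   | i , z-record , z≡max =
    contradiction (subst (_< toℕ x) (sym z≡max) (pathMax-par<record x-record)) (least _ z-record)

  properAncestor : ∀ {i y z} → iter v (suc i) y ≡ z → z ≢ zero → ProperAncestor v z y
  properAncestor {i} {y} reach z≢0 =
    fromℕ< i<n , trans (cong (λ j → iter v (suc j) y) (toℕ-fromℕ< i<n)) reach
    where
    i<n : i < n
    i<n with i <? n
    ... | yes i<n = i<n
    ... | no  i≮n =
      contradiction (trans (sym reach) (iter-≥-root y (≤-trans (≮⇒≥ i≮n) (n≤1+n i)))) z≢0

-- Re-hanging records

module Rehanging {n} {v v′ : ParentVec n} (tree : IsTree v)
  (keeps-nonrecords : ∀ {x} → ¬ IsRecord v x → par v′ x ≡ par v x)
  (lowers-records   : ∀ x → IsRecord v x → pathMax v (par v′ x) < toℕ x) where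

  pathMax-par′ : ∀ x → pathMax v (par v′ x) ≤ pathMax v x
  pathMax-par′ x with isRecord? v x
  ... | yes x-record = ≤-trans (<⇒≤ (lowers-records x x-record)) (label≤pathMax v x)
  ... | no ¬record  =
    subst (λ y → pathMax v y ≤ pathMax v x) (sym (keeps-nonrecords ¬record)) (pathMax-par tree x)

  pathMax-iter′ : ∀ k x → pathMax v (iter v′ k x) ≤ pathMax v x
  pathMax-iter′ zero    x = ≤-refl
  pathMax-iter′ (suc k) x = ≤-trans (pathMax-par′ (iter v′ k x)) (pathMax-iter′ k x)

  -- A record step lowers pathMax v; any other step follows v towards the root.
  reachesRoot′ : ∀ m x → pathMax v x < m → ReachesRoot v′ x
  reachesRoot′ zero    x ()
  reachesRoot′ (suc m) x x<m = along-v n x x<m (tree x)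
    where
    along-v : ∀ r y → pathMax v y < suc m → iter v r y ≡ zero → ReachesRoot v′ y
    along-v zero    y _   reach = 0 , reach
    along-v (suc r) y y<m reach with isRecord? v y
    ... | yes y-record = reachesRoot-par v′ (reachesRoot′ m (par v′ y)
          (<-≤-trans (lowers-records y y-record) (≤-trans (label≤pathMax v y) (≤-pred y<m))))
    ... | no ¬record   = reachesRoot-par v′ (subst (ReachesRoot v′) (sym (keeps-nonrecords ¬record))
          (along-v r (par v y) (≤-<-trans (pathMax-par tree y) y<m) (trans (sym (iter-suc v r y)) reach)))

  isTree′ : IsTree v′
  isTree′ = reachesRoot⇒IsTree v′ λ x → reachesRoot′ (suc (pathMax v x)) x ≤-refl

  records⊆ : IsRecord v ⊆ IsRecord v′
  records⊆ {x} x-record@(x≢0 , _) = pathMax≤⇒record v′ x≢0 (≤-trans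
    (pathMax-lub v′ x λ i → ≤-trans (label≤pathMax v (iter v′ i x)) (pathMax-iter′ i x))
    (record⇒pathMax≤ v x-record))

  -- Up to the first record ancestor of a non-record x, its paths in v and v′ coincide.
  pathMax≤pathMax′ : ∀ r x → ¬ IsRecord v x → iter v r x ≡ zero → pathMax v x ≤ pathMax v′ x
  pathMax≤pathMax′ r       zero      _       _     = subst (_≤ pathMax v′ zero) (sym (maxLabel-root v n)) z≤n
  pathMax≤pathMax′ zero    (suc _)   _       ()
  pathMax≤pathMax′ (suc r) x@(suc _) ¬record reach = begin
    pathMax v x           ≤⟨ nonrecord-pathMax≤pathMax-par tree (λ ()) ¬record ⟩
    pathMax v (par v x)   ≤⟨ par-bound ⟩
    pathMax v′ (par v x)  ≡⟨ cong (pathMax v′) (keeps-nonrecords ¬record) ⟨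
    pathMax v′ (par v′ x) ≤⟨ pathMax-par isTree′ x ⟩
    pathMax v′ x          ∎
    where
    open ≤-Reasoning
    par-bound : pathMax v (par v x) ≤ pathMax v′ (par v x)
    par-bound with isRecord? v (par v x)
    ... | yes p-record = ≤-trans (record⇒pathMax≤ v p-record) (label≤pathMax v′ (par v x))
    ... | no ¬p-record = pathMax≤pathMax′ r (par v x) ¬p-record (trans (sym (iter-suc v r x)) reach)

  records⊇ : IsRecord v′ ⊆ IsRecord v
  records⊇ {x} x-record′@(x≢0 , _) with isRecord? v x
  ... | yes x-record = x-record
  ... | no ¬record  = pathMax≤⇒record v x≢0
    (≤-trans (pathMax≤pathMax′ n x ¬record (tree x)) (record⇒pathMax≤ v′ x-record′))

  sameRecords : IsRecord v ≐ IsRecord v′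
  sameRecords = records⊆ , records⊇

shiftedParent : ∀ {n} → SearchableOrder (suc n) → ParentVec n → Fin (suc n) → Fin (suc n)
shiftedParent O v x with isRecord? v x | next? O (isRecord? v) x
... | no _  | _           = par v x
... | yes _ | yes (y , _) = par v y
... | yes _ | no _        = zero

shift : ∀ {n} → SearchableOrder (suc n) → ParentVec n → ParentVec n
shift O v = tabulate (shiftedParent O v ∘ suc)

par-extensional : ∀ {n} {v w : ParentVec n} → (∀ x → par v x ≡ par w x) → v ≡ w
par-extensional {v = v} {w} same = begin
  v                  ≡⟨ tabulate∘lookup v ⟨
  tabulate (lookup v) ≡⟨ tabulate-cong (same ∘ suc) ⟩
  tabulate (lookup w) ≡⟨ tabulate∘lookup w ⟩
  w                  ∎
  where open ≡-Reasoning

module _ {n} (O : SearchableOrder (suc n)) (v : ParentVec n) where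
  open SearchableOrder O

  par-shift : ∀ x → par (shift O v) x ≡ shiftedParent O v x
  par-shift zero with isRecord? v zero
  ... | yes (0≢0 , _) = contradiction refl 0≢0
  ... | no _          = refl
  par-shift (suc i) = lookup∘tabulate (shiftedParent O v ∘ suc) i

  par-shift-nonrecord : ∀ {x} → ¬ IsRecord v x → par (shift O v) x ≡ par v x
  par-shift-nonrecord {x} ¬record with isRecord? v x | par-shift x
  ... | yes x-record | _  = contradiction x-record ¬record
  ... | no _         | eq = eq

  par-shift-record : ∀ {x} → IsRecord v x →
    (∃ λ y → Next _≺_ (IsRecord v) x y × par (shift O v) x ≡ par v y) ⊎
    ((∀ z → IsRecord v z → ¬ x ≺ z) × par (shift O v) x ≡ zero)
  par-shift-record {x} x-record with isRecord? v x | next? O (isRecord? v) x | par-shift x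
  ... | no ¬record | _              | _  = contradiction x-record ¬record
  ... | yes _      | yes (y , next) | eq = inj₁ (y , next , eq)
  ... | yes _      | no ∄next       | eq = inj₂ (∄Next⇒last O (isRecord? v) ∄next , eq)

  par-shift-next : ∀ {x y} → IsRecord v x → Next _≺_ (IsRecord v) x y → par (shift O v) x ≡ par v y
  par-shift-next x-record next@(y-record , x≺y , _) with par-shift-record x-record
  ... | inj₁ (_ , next′ , eq) = trans eq (cong (par v) (Next-unique O next′ next))
  ... | inj₂ (last , _)       = contradiction x≺y (last _ y-record)

  par-shift-last : ∀ {x} → IsRecord v x → (∀ z → IsRecord v z → ¬ x ≺ z) →
    par (shift O v) x ≡ zero
  par-shift-last x-record last with par-shift-record x-record
  ... | inj₁ (y , (y-record , x≺y , _) , _) = contradiction x≺y (last y y-record)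
  ... | inj₂ (_ , eq)                       = eq

  shift-lowers-records :
    (∀ {x y} → IsRecord v x → Next _≺_ (IsRecord v) x y → pathMax v (par v y) < toℕ x) →
    ∀ x → IsRecord v x → pathMax v (par (shift O v) x) < toℕ x
  shift-lowers-records next-bound x x-record with par-shift-record x-record
  ... | inj₁ (y , next , eq) = subst (λ p → pathMax v p < toℕ x) (sym eq) (next-bound x-record next)
  ... | inj₂ (_ , eq)        = subst (λ p → pathMax v p < toℕ x) (sym eq) (pathMax-root<record v x-record)

shift-inverse : ∀ {n} (O O′ : SearchableOrder (suc n)) {v : ParentVec n} →
  let open SearchableOrder O; open SearchableOrder O′ using () renaming (_≺_ to _≺′_) in
  (∀ {P x y} → P x → Next _≺′_ P x y → Next _≺_ P y x) →
  IsRecord v ≐ IsRecord (shift O v) →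
  (∀ {x} → IsRecord v x → (∀ z → IsRecord v z → ¬ x ≺′ z) → par v x ≡ zero) →
  shift O′ (shift O v) ≡ v
shift-inverse O O′ {v} converse (⊆′ , ⊇′) last-at-root = par-extensional same-parent
  where
  open SearchableOrder O′ using () renaming (_≺_ to _≺′_)
  v′ = shift O v
  same-parent : ∀ x → par (shift O′ v′) x ≡ par v x
  same-parent x = by-cases (isRecord? v x)
    where
    by-cases : Dec (IsRecord v x) → par (shift O′ v′) x ≡ par v x
    by-cases (no ¬record) =
      trans (par-shift-nonrecord O′ v′ (¬record ∘ ⊇′)) (par-shift-nonrecord O v ¬record)
    by-cases (yes x-record) =
      [ (λ (y , next′ , eq) → trans eq (shifted-back next′))
      , (λ (last′ , eq) → trans eq (sym (last-at-root x-record (last-in-v last′)))) ]′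
      (par-shift-record O′ v′ (⊆′ x-record))
      where
      shifted-back : ∀ {y} → Next _≺′_ (IsRecord v′) x y → par v′ y ≡ par v x
      shifted-back next′ = par-shift-next O v (⊇′ (proj₁ next′))
        (converse x-record (Next-resp-≐ {_≺_ = _≺′_} (⊇′ , ⊆′) next′))
      last-in-v : (∀ z → IsRecord v′ z → ¬ x ≺′ z) → ∀ z → IsRecord v z → ¬ x ≺′ z
      last-in-v last′ z z-record = last′ z (⊆′ z-record)

-- The bijection

module _ {n} {v : ParentVec (suc n)} (tree : IsTree v) (noDRC : NoDRCPair v) where

  pathMax-par-next<record : ∀ {x y} → IsRecord v x → Next Fin._<_ (IsRecord v) x y →
    pathMax v (par v y) < toℕ x
  pathMax-par-next<record {x} {y} x-record (y-record , x<y , between) with par v y ≟ zero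
  ... | yes root = subst (λ p → pathMax v p < toℕ x) (sym root) (pathMax-root<record v x-record)
  ... | no ¬root with pathMax-attained-at-record tree ¬root
  ...   | i , z-record , z≡max = subst (_< toℕ x) z≡max z<x
    where
    z = iter v i (par v y)
    z<y : toℕ z < toℕ y
    z<y = subst (_< toℕ y) (sym z≡max) (pathMax-par<record tree y-record)
    z≢x : z ≢ x
    z≢x refl = noDRC z y
      (z-record , y-record , properAncestor tree {i} (iter-suc v i y) (proj₁ z-record) , x<y , between)
    z<x : toℕ z < toℕ x
    z<x = ≤∧≢⇒< (≮⇒≥ λ x<z → between z z-record x<z z<y) (z≢x ∘ toℕ-injective)

  private
    module Up = Rehanging tree (par-shift-nonrecord ascending v)
                  (shift-lowers-records ascending v pathMax-par-next<record)

  shift-ascending-isTree : IsTree (shift ascending v)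
  shift-ascending-isTree = Up.isTree′

  shift-ascending-top-child-of-root : par (shift ascending v) (fromℕ (suc n)) ≡ zero
  shift-ascending-top-child-of-root =
    par-shift-last ascending v (fromℕ-record v) λ z _ top<z → <⇒≱ top<z (≤fromℕ z)

  shift-descending∘ascending : shift descending (shift ascending v) ≡ v
  shift-descending∘ascending = shift-inverse ascending descending (Next-flip {_≺_ = Fin._>_})
    Up.sameRecords (least-record-child-of-root tree)

module _ {n} {w : ParentVec (suc n)} (tree : IsTree w) (top-child : par w (fromℕ (suc n)) ≡ zero) where

  pathMax-par-previous<record : ∀ {x y} → IsRecord w x → Next Fin._>_ (IsRecord w) x y →
    pathMax w (par w y) < toℕ x
  pathMax-par-previous<record _ (y-record , y<x , _) = <-trans (pathMax-par<record tree y-record) y<x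

  private
    module Down = Rehanging tree (par-shift-nonrecord descending w)
                    (shift-lowers-records descending w pathMax-par-previous<record)

  shift-descending-isTree : IsTree (shift descending w)
  shift-descending-isTree = Down.isTree′

  shift-descending-noDRC : NoDRCPair (shift descending w)
  shift-descending-noDRC R R′ (R-record′ , R′-record′ , (k , reach) , R<R′ , between) =
    <-irrefl refl (begin-strict
      pathMax w R                             ≡⟨ cong (pathMax w) reach ⟨
      pathMax w (iter w′ (suc (toℕ k)) R′)     ≡⟨ cong (pathMax w) (iter-suc w′ (toℕ k) R′) ⟩
      pathMax w (iter w′ (toℕ k) (par w′ R′))  ≡⟨ cong (pathMax w ∘ iter w′ (toℕ k)) par-R′ ⟩
      pathMax w (iter w′ (toℕ k) (par w R))    ≤⟨ Down.pathMax-iter′ (toℕ k) (par w R) ⟩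
      pathMax w (par w R)                     <⟨ pathMax-par<record tree R-record ⟩
      toℕ R                                   ≤⟨ label≤pathMax w R ⟩
      pathMax w R                             ∎)
    where
    open ≤-Reasoning
    w′ = shift descending w
    R-record = Down.records⊇ R-record′
    R′-record = Down.records⊇ R′-record′
    par-R′ : par w′ R′ ≡ par w R
    par-R′ = par-shift-next descending w R′-record (Next-flip R-record
      (Next-resp-≐ {_≺_ = Fin._<_} (Down.records⊇ , Down.records⊆) (R′-record′ , R<R′ , between)))

  shift-ascending∘descending : shift ascending (shift descending w) ≡ w
  shift-ascending∘descending = shift-inverse descending ascending (Next-flip {_≺_ = Fin._<_})
    Down.sameRecords top-at-root
    where
    top-at-root : ∀ {x} → IsRecord w x → (∀ z → IsRecord w z → ¬ x Fin.< z) → par w x ≡ zero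
    top-at-root {x} _ last =
      trans (cong (par w) (≤ᶠ-antisym (≤fromℕ x) (≮⇒≥ (last _ (fromℕ-record w))))) top-child


corollary3p6 : (n : ℕ) → 1 ≤ n → countNoDRC n ≡ countNChildOfRoot n
corollary3p6 zero    ()
corollary3p6 (suc n) _ =
  length-filter-≡ (λ v → isTree? v ×-dec noDRCPair? v)
                  (λ v → isTree? v ×-dec (par v (fromℕ (suc n)) ≟ zero))
    (allVecs-unique (suc n)) (allVecs-complete (suc n)) (shift ascending) (shift descending)
    (λ (tree , noDRC) → shift-ascending-isTree tree noDRC , shift-ascending-top-child-of-root tree noDRC)
    (λ (tree , top)   → shift-descending-isTree tree top , shift-descending-noDRC tree top)
    (λ (tree , noDRC) → shift-descending∘ascending tree noDRC)
    (λ (tree , top)   → shift-ascending∘descending tree top)
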